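{- Let $\ell\ge1$, let $\mathcal{T}$ be an $\ell$-index-tree, and let $i,j\in\{1,\dots,\ell\}$ be such that $j\in\mathcal{T}(i)$ and $i$ has a parent $i'$ in $\mathcal{T}$. Then every factor of the word $B(\ell)$ that starts with an occurrence of $i'$ and ends with an occurrence of $j$ contains every integer $m$ with $j\le m\le i$.
   Context: A partial binary tree is a rooted tree in which every node has at most one left child and at most one right child. An $\ell$-index-tree is a partial binary tree whose vertices (indices) are $1,\dots,\ell$, labelled so that in the depth-first preorder traversal from the root visiting left children before right children, the $k$-th visited node gets label $\ell+1-k$. For an index $i$, $i^-$, $i^+$ are its left and right children, and $\mathcal{T}(i)$ is the subtree rooted at $i$. Words are finite sequences of letters; $\circ$ denotes concatenation; a factor of a word is a contiguous subword. The full index-barrier $B(i)$, for $i\in\{1,\dots,\ell\}$, is the word over $\{1,\dots,i\}$ defined recursively by: $B(i)=i$ if $i$ is a leaf; $B(i)=i\circ B(i-1)\circ i$ if $i$ has exactly one child (which is necessarily $i-1$); and $B(i)=i\circ B(i^-)\circ i\circ B(i^+)\circ i\circ B(i^-)\circ i$ if $i$ has two children. -}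

module Defs where

open import Data.Nat using (ℕ; zero; suc; _+_; _∸_)
open import Data.Maybe using (Maybe; just; nothing)
open import Data.List using (List; []; _∷_; _++_; [_])
open import Data.Product using (_×_; _,_; ∃)
open import Data.List.Membership.Propositional using (_∈_)
open import Relation.Binary.PropositionalEquality using (_≡_)
open import Relation.Binary.Construct.Closure.ReflexiveTransitive using (Star)

data PBT : Set where
  node : Maybe PBT → Maybe PBT → PBT

mutual
  size : PBT → ℕ
  size (node l r) = suc (sizeM l + sizeM r)

  sizeM : Maybe PBT → ℕ
  sizeM nothing  = 0
  sizeM (just t) = size t

-- Labelling convention: an ℓ-index-tree is a PBT t with size t ≡ ℓ whose
-- k-th node in depth-first preorder (root, left subtree, right subtree)
-- gets label ℓ+1-k.  Hence the root has label ℓ, and in a subtree whose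
-- root has label r, the left child has label r-1 and the right child has
-- label r-1-(size of the left subtree).

leftLabel : ℕ → ℕ
leftLabel r = r ∸ 1

rightLabel : Maybe PBT → ℕ → ℕ
rightLabel l r = r ∸ 1 ∸ sizeM l

edges : PBT → ℕ → List (ℕ × ℕ)
edges (node l rt) r = edgesL l ++ edgesR rt
  where
  edgesL : Maybe PBT → List (ℕ × ℕ)
  edgesL nothing  = []
  edgesL (just L) = (r , leftLabel r) ∷ edges L (leftLabel r)
  edgesR : Maybe PBT → List (ℕ × ℕ)
  edgesR nothing  = []
  edgesR (just R) = (r , rightLabel l r) ∷ edges R (rightLabel l r)

record IndexTree (ℓ : ℕ) : Set where
  constructor mkIndexTree
  field
    tree   : PBT
    size≡ℓ : size tree ≡ ℓ
open IndexTree public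

IsParent : ∀ {ℓ} → IndexTree ℓ → ℕ → ℕ → Set
IsParent {ℓ} T p c = (p , c) ∈ edges (tree T) ℓ

InSubtree : ∀ {ℓ} → IndexTree ℓ → ℕ → ℕ → Set
InSubtree T i j = Star (IsParent T) i j

barrier : PBT → ℕ → List ℕ
barrier (node nothing  nothing)  r = [ r ]
barrier (node (just L) nothing)  r = r ∷ barrier L (leftLabel r) ++ [ r ]
barrier (node nothing  (just R)) r = r ∷ barrier R (rightLabel nothing r) ++ [ r ]
barrier (node (just L) (just R)) r =
  r ∷ barrier L (leftLabel r) ++ r ∷ barrier R (rightLabel (just L) r)
    ++ r ∷ barrier L (leftLabel r) ++ [ r ]

B : ∀ {ℓ} → IndexTree ℓ → List ℕ
B {ℓ} T = barrier (tree T) ℓ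

IsFactor : List ℕ → List ℕ → Set
IsFactor f w = ∃ λ u → ∃ λ v → w ≡ u ++ f ++ v

-- The labels of the subtree rooted at r form an interval ending at r, and the
-- barrier of r is made of copies of r and of the barriers of its children.
-- Walking from the root down to i, every occurrence of a label j of the subtree
-- of i therefore lies inside a copy of B(i).  Walking on from i down to j, every
-- label m with j ≤ m ≤ i occurs in that copy before the occurrence of j: m is
-- the current node, or lies in its left subtree, whose barrier is written out
-- completely before the right subtree is entered, or lies in the child leading
-- to j.  The parent i′ of i has a larger label, so it does not occur in B(i),
-- and a factor running from an occurrence of i′ to j contains the whole part of
-- that copy of B(i) before j.

module Submission where

open import Defs
open import Data.Nat using (ℕ; suc; _+_; _∸_; _≤_; _<_; _≤?_; s≤s)
open import Data.Nat.Properties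
open import Data.Maybe using (just; nothing)
open import Data.List using (List; []; _∷_; _++_; [_])
open import Data.List.Properties using (++-assoc; ++-cancelˡ; ∷-injective; ∷-injectiveʳ)
open import Data.List.Membership.Propositional using (_∈_; _∉_)
open import Data.List.Membership.Propositional.Properties using (∈-++⁺ˡ; ∈-++⁺ʳ; ∈-++⁻)
open import Data.List.Relation.Unary.Any using (here; there)
open import Data.Product using (_×_; _,_; ∃; ∃₂; proj₁; proj₂; map₁; map₂)
open import Data.Sum using (_⊎_; inj₁; inj₂)
import Data.Sum as Sum
open import Relation.Nullary using (¬_; yes; no; contradiction)
open import Relation.Binary.PropositionalEquality using (_≡_; _≢_; refl; sym; trans; cong; subst)
open import Relation.Binary.Construct.Closure.ReflexiveTransitive using (Star; ε; _◅_; _◅◅_)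

module _ {A : Set} where

  private variable
    j k : A
    b u w x y : List A

  occurrence-++ : ∀ (a : List A) → a ++ b ≡ x ++ j ∷ y →
                  (∃ λ c → a ≡ x ++ j ∷ c) ⊎ (∃ λ p → x ≡ a ++ p × b ≡ p ++ j ∷ y)
  occurrence-++ {x = x}     []      eq = inj₂ (x , refl , eq)
  occurrence-++ {x = []}    (k ∷ a) eq with refl , _ ← ∷-injective eq = inj₁ (a , refl)
  occurrence-++ {x = _ ∷ _} (k ∷ a) eq
    with refl , eq′ ← ∷-injective eq
    with occurrence-++ a eq′
  ... | inj₁ (c , refl)       = inj₁ (c , refl)
  ... | inj₂ (p , refl , eq″) = inj₂ (p , refl , eq″)

  occurrence⇒∈ : w ≡ x ++ j ∷ y → j ∈ w
  occurrence⇒∈ {x = x} refl = ∈-++⁺ʳ x (here refl)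

  occurrence-++ʳ : ∀ (a : List A) → j ∉ a → a ++ b ≡ x ++ j ∷ y →
                   ∃ λ p → x ≡ a ++ p × b ≡ p ++ j ∷ y
  occurrence-++ʳ a j∉a eq with occurrence-++ a eq
  ... | inj₁ (_ , a≡) = contradiction (occurrence⇒∈ a≡) j∉a
  ... | inj₂ in-b     = in-b

  ∉-++ : ∀ a → j ∉ a → j ∉ b → j ∉ a ++ b
  ∉-++ a j∉a j∉b j∈ = Sum.[ j∉a , j∉b ]′ (∈-++⁻ a j∈)

  suffix-after-∉ : ∀ (x₁ : List A) {x₂ h} → x₁ ++ x₂ ≡ u ++ k ∷ h → k ∉ x₂ →
                   ∃ λ p → h ≡ p ++ x₂
  suffix-after-∉ {u = u} x₁ {x₂} eq k∉x₂ with occurrence-++ x₁ eq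
  ... | inj₂ (_ , _ , x₂≡) = contradiction (occurrence⇒∈ x₂≡) k∉x₂
  ... | inj₁ (c , refl)    =
    c , sym (∷-injectiveʳ (++-cancelˡ u _ _ (trans (sym (++-assoc u _ x₂)) eq)))

  split-ends : ∀ {f g h} → f ≡ k ∷ g → f ≡ h ++ [ j ] → k ≢ j →
               ∃ λ mid → f ≡ k ∷ mid ++ [ j ]
  split-ends {h = []}      refl eq k≢j = contradiction (proj₁ (∷-injective eq)) k≢j
  split-ends {h = _ ∷ mid} refl eq _ with refl , _ ← ∷-injective eq = mid , eq

  -- Within w j x: the occurrence of j right after the prefix x lies inside a copy of w.
  Within : List A → A → List A → Set
  Within w j x = ∃₂ λ x₁ x₂ → x ≡ x₁ ++ x₂ × ∃ λ y → w ≡ x₂ ++ j ∷ y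

  Within-here : w ≡ x ++ j ∷ y → Within w j x
  Within-here {x = x} {y = y} eq = [] , x , refl , y , eq

  Within-++ : ∀ a → Within w j x → Within w j (a ++ x)
  Within-++ a (x₁ , x₂ , refl , occ) = a ++ x₁ , x₂ , sym (++-assoc a x₁ x₂) , occ

  Within-trans : ∀ {w′} → Within w j x →
                 (∀ {x′ y′} → w ≡ x′ ++ j ∷ y′ → Within w′ j x′) → Within w′ j x
  Within-trans (x₁ , _ , refl , _ , occ) inner = Within-++ x₁ (inner occ)

bracketed-factor⇒occurrence : ∀ {w k mid j} → IsFactor (k ∷ mid ++ [ j ]) w →
                              ∃₂ λ u v → w ≡ (u ++ k ∷ mid) ++ j ∷ v
bracketed-factor⇒occurrence {k = k} {mid} {j} (u , v , refl) =
  u , v , trans (cong (λ z → u ++ k ∷ z) (++-assoc mid [ j ] v))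
                (sym (++-assoc u (k ∷ mid) (j ∷ v)))

-- A labelled subtree is a pair (t , r) of a tree and the label of its root;
-- Star Child (t , r) (t′ , k) says that k labels a node of t with subtree t′.
data Child : PBT × ℕ → PBT × ℕ → Set where
  left  : ∀ {L R r} → Child (node (just L) R , r) (L , leftLabel r)
  right : ∀ {l R r} → Child (node l (just R) , r) (R , rightLabel l r)

-- Validity rules out truncated subtraction in leftLabel and rightLabel: every
-- node of a valid (t , r) has a positive label.
Valid : PBT × ℕ → Set
Valid (t , r) = size t ≤ r

_∈⟨_,_] : ℕ → ℕ → ℕ → Set
k ∈⟨ a , b ] = a < k × k ≤ b

InRange : PBT × ℕ → ℕ → Set
InRange (t , r) k = k ∈⟨ r ∸ size t , r ]

∈⟨⟩-empty : ∀ {k a} → ¬ k ∈⟨ a , a ]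
∈⟨⟩-empty (a<k , k≤a) = <⇒≱ a<k k≤a

∈⟨⟩-disjoint : ∀ {k a b c} → k ∈⟨ b , c ] → ¬ k ∈⟨ a , b ]
∈⟨⟩-disjoint (b<k , _) (_ , k≤b) = <⇒≱ b<k k≤b

Child-valid : ∀ {s s′} → Child s s′ → Valid s → Valid s′
Child-valid left (s≤s v) = m+n≤o⇒m≤o _ v
Child-valid (right {l} {R}) (s≤s {n = r′} v) =
  m+n≤o⇒m≤o∸n (size R) (subst (_≤ r′) (+-comm (sizeM l) (size R)) v)

Star-valid : ∀ {s s′} → Star Child s s′ → Valid s → Valid s′
Star-valid ε          v = v
Star-valid (c ◅ path) v = Star-valid path (Child-valid c v)

Child-label< : ∀ {t r c rc} → Child (t , r) (c , rc) → Valid (t , r) → rc < r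
Child-label< left            (s≤s _)          = n<1+n _
Child-label< (right {l = l}) (s≤s {n = r′} _) = s≤s (m∸n≤m r′ (sizeM l))

root-InRange : ∀ {t r} → Valid (t , r) → InRange (t , r) r
root-InRange {node l R} (s≤s {n = r′} _) = s≤s (m∸n≤m r′ (sizeM l + sizeM R)) , ≤-refl

Child-InRange : ∀ {s s′ k} → Child s s′ → Valid s → InRange s′ k → InRange s k
Child-InRange (left {L} {R}) (s≤s {n = r′} _) (lo<k , k≤r′) =
  ≤-<-trans (∸-monoʳ-≤ r′ (m≤m+n (size L) (sizeM R))) lo<k , m≤n⇒m≤1+n k≤r′
Child-InRange {k = k} (right {l} {R}) (s≤s {n = r′} _) (lo<k , k≤mid) =
    subst (_< k) (∸-+-assoc r′ (sizeM l) (size R)) lo<k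
  , m≤n⇒m≤1+n (≤-trans k≤mid (m∸n≤m r′ (sizeM l)))

Star-InRange : ∀ {s s′ k} → Star Child s s′ → Valid s → InRange s′ k → InRange s k
Star-InRange ε          _ k∈ = k∈
Star-InRange (c ◅ path) v k∈ = Child-InRange c v (Star-InRange path (Child-valid c v) k∈)

path⇒InRange : ∀ {s t′ k} → Valid s → Star Child s (t′ , k) → InRange s k
path⇒InRange v path = Star-InRange path v (root-InRange (Star-valid path v))

InRange-node : ∀ {l R r′ k} → InRange (node l R , suc r′) k →
               k ≡ suc r′ ⊎ k ∈⟨ r′ ∸ sizeM l , r′ ]
                          ⊎ k ∈⟨ r′ ∸ sizeM l ∸ sizeM R , r′ ∸ sizeM l ]
InRange-node {l} {R} {r′} {k} (lo<k , k≤r) with m≤n⇒m<n∨m≡n k≤r | k ≤? r′ ∸ sizeM l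
... | inj₂ k≡r | _         = inj₁ k≡r
... | inj₁ k<r | yes k≤mid =
  inj₂ (inj₂ (subst (_< k) (sym (∸-+-assoc r′ (sizeM l) (sizeM R))) lo<k , k≤mid))
... | inj₁ k<r | no  k≰mid = inj₂ (inj₁ (≰⇒> k≰mid , ≤-pred k<r))

InRange⇒path : ∀ {t r k} → Valid (t , r) → InRange (t , r) k →
               ∃ λ t′ → Star Child (t , r) (t′ , k)
InRange⇒path {node l R} v@(s≤s _) k∈ with InRange-node {l} {R} k∈
... | inj₁ refl = _ , ε
InRange⇒path {node nothing  R} v k∈ | inj₂ (inj₁ k∈L) = contradiction k∈L ∈⟨⟩-empty
InRange⇒path {node (just L) R} v k∈ | inj₂ (inj₁ k∈L) =
  map₂ (left ◅_) (InRange⇒path {L} (Child-valid (left {L} {R}) v) k∈L)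
InRange⇒path {node l nothing}  v k∈ | inj₂ (inj₂ k∈R) = contradiction k∈R ∈⟨⟩-empty
InRange⇒path {node l (just R)} v k∈ | inj₂ (inj₂ k∈R) =
  map₂ (right ◅_) (InRange⇒path {R} (Child-valid (right {l} {R}) v) k∈R)

root∈barrier : ∀ {l R} r → r ∈ barrier (node l R) r
root∈barrier {nothing} {nothing} r = here refl
root∈barrier {nothing} {just _}  r = here refl
root∈barrier {just _}  {nothing} r = here refl
root∈barrier {just _}  {just _}  r = here refl

Child-⊆-barrier : ∀ {t r c rc k} → Child (t , r) (c , rc) →
                  k ∈ barrier c rc → k ∈ barrier t r
Child-⊆-barrier (left {R = nothing})  k∈ = there (∈-++⁺ˡ k∈)
Child-⊆-barrier (left {R = just _})   k∈ = there (∈-++⁺ˡ k∈)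
Child-⊆-barrier (right {l = nothing}) k∈ = there (∈-++⁺ˡ k∈)
Child-⊆-barrier (right {l = just L})  k∈ = there (∈-++⁺ʳ (barrier L _) (there (∈-++⁺ˡ k∈)))

path⇒∈barrier : ∀ {t r t′ k} → Star Child (t , r) (t′ , k) → k ∈ barrier t r
path⇒∈barrier {node _ _} ε = root∈barrier _
path⇒∈barrier (c ◅ path)   = Child-⊆-barrier c (path⇒∈barrier path)

∈barrier⇒path : ∀ t r {k} → k ∈ barrier t r → ∃ λ t′ → Star Child (t , r) (t′ , k)
∈barrier⇒path (node nothing  nothing)  r (here refl) = _ , ε
∈barrier⇒path (node (just L) nothing)  r (here refl) = _ , ε
∈barrier⇒path (node (just L) nothing)  r (there k∈) with ∈-++⁻ (barrier L _) k∈
... | inj₁ k∈L         = map₂ (left ◅_) (∈barrier⇒path L _ k∈L)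
... | inj₂ (here refl) = _ , ε
∈barrier⇒path (node nothing  (just R)) r (here refl) = _ , ε
∈barrier⇒path (node nothing  (just R)) r (there k∈) with ∈-++⁻ (barrier R _) k∈
... | inj₁ k∈R         = map₂ (right ◅_) (∈barrier⇒path R _ k∈R)
... | inj₂ (here refl) = _ , ε
∈barrier⇒path (node (just L) (just R)) r (here refl) = _ , ε
∈barrier⇒path (node (just L) (just R)) r (there k∈) with ∈-++⁻ (barrier L _) k∈
... | inj₁ k∈L         = map₂ (left ◅_) (∈barrier⇒path L _ k∈L)
... | inj₂ (here refl) = _ , ε
... | inj₂ (there k∈′) with ∈-++⁻ (barrier R _) k∈′
...   | inj₁ k∈R         = map₂ (right ◅_) (∈barrier⇒path R _ k∈R)
...   | inj₂ (here refl) = _ , ε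
...   | inj₂ (there k∈″) with ∈-++⁻ (barrier L _) k∈″
...     | inj₁ k∈L         = map₂ (left ◅_) (∈barrier⇒path L _ k∈L)
...     | inj₂ (here refl) = _ , ε

InRange⇒∈barrier : ∀ {t r k} → Valid (t , r) → InRange (t , r) k → k ∈ barrier t r
InRange⇒∈barrier v k∈ = path⇒∈barrier (proj₂ (InRange⇒path v k∈))

∈barrier⇒InRange : ∀ {t r k} → Valid (t , r) → k ∈ barrier t r → InRange (t , r) k
∈barrier⇒InRange v k∈ = path⇒InRange v (proj₂ (∈barrier⇒path _ _ k∈))

descendant-label<parent : ∀ {tp p tc c td d} → Valid (tp , p) → Child (tp , p) (tc , c) →
                          Star Child (tc , c) (td , d) → d < p
descendant-label<parent v step path =
  ≤-<-trans (proj₂ (path⇒InRange (Child-valid step v) path)) (Child-label< step v)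

parent∉barrier : ∀ {tp p tc c} → Valid (tp , p) → Child (tp , p) (tc , c) → p ∉ barrier tc c
parent∉barrier v step p∈ =
  <-irrefl refl (descendant-label<parent v step (proj₂ (∈barrier⇒path _ _ p∈)))

subtree-unique : ∀ {s t₁ t₂ k} → Valid s → Star Child s (t₁ , k) → Star Child s (t₂ , k) → t₁ ≡ t₂
subtree-unique v ε               ε               = refl
subtree-unique v ε               (c ◅ path)      = contradiction (descendant-label<parent v c path) (<-irrefl refl)
subtree-unique v (c ◅ path)      ε               = contradiction (descendant-label<parent v c path) (<-irrefl refl)
subtree-unique v (c@left ◅ p₁)   (left ◅ p₂)     = subtree-unique (Child-valid c v) p₁ p₂
subtree-unique v (c@right ◅ p₁)  (right ◅ p₂)    = subtree-unique (Child-valid c v) p₁ p₂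
subtree-unique v (cl@left ◅ p₁)  (cr@right ◅ p₂) =
  contradiction (path⇒InRange (Child-valid cr v) p₂) (∈⟨⟩-disjoint (path⇒InRange (Child-valid cl v) p₁))
subtree-unique v (cr@right ◅ p₁) (cl@left ◅ p₂)  =
  contradiction (path⇒InRange (Child-valid cr v) p₁) (∈⟨⟩-disjoint (path⇒InRange (Child-valid cl v) p₂))

edge⇒path : ∀ t r {p c} → (p , c) ∈ edges t r →
            ∃ λ tp → Star Child (t , r) (tp , p) × ∃ λ tc → Child (tp , p) (tc , c)
edge⇒path (node nothing  (just R)) r (here refl) = _ , ε , _ , right
edge⇒path (node nothing  (just R)) r (there e)   = map₂ (map₁ (right ◅_)) (edge⇒path R _ e)
edge⇒path (node (just L) R)        r (here refl) = _ , ε , _ , left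
edge⇒path (node (just L) R)        r (there e) with ∈-++⁻ (edges L (leftLabel r)) e
... | inj₁ e′ = map₂ (map₁ (left ◅_)) (edge⇒path L _ e′)
edge⇒path (node (just L) (just R)) r (there e) | inj₂ (here refl) = _ , ε , _ , right
edge⇒path (node (just L) (just R)) r (there e) | inj₂ (there e′)  =
  map₂ (map₁ (right ◅_)) (edge⇒path R _ e′)

child-label∉root : ∀ {t r c rc j} → Child (t , r) (c , rc) → Valid (t , r) →
                   InRange (c , rc) j → j ∉ [ r ]
child-label∉root c v (_ , j≤rc) (here refl) = <⇒≱ (Child-label< c v) j≤rc

left-label∉right : ∀ {L R r j} → Valid (node (just L) (just R) , r) →
                   InRange (L , leftLabel r) j → j ∉ barrier R (rightLabel (just L) r)
left-label∉right v j∈L j∈R = ∈⟨⟩-disjoint j∈L (∈barrier⇒InRange (Child-valid right v) j∈R)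

right-label∉left : ∀ {L R r j} → Valid (node (just L) (just R) , r) →
                   InRange (R , rightLabel (just L) r) j → j ∉ barrier L (leftLabel r)
right-label∉left v j∈R j∈L = ∈⟨⟩-disjoint (∈barrier⇒InRange (Child-valid left v) j∈L) j∈R

above-root : ∀ {m r′ x} → m ≤ suc r′ → r′ < m → m ∈ suc r′ ∷ x
above-root m≤r r′<m = here (≤-antisym m≤r r′<m)

occurrence-in-left-child : ∀ {L R r′ x j y} → Valid (node (just L) R , suc r′) →
                           InRange (L , r′) j → j ∉ [ suc r′ ] →
                           barrier (node (just L) R) (suc r′) ≡ x ++ j ∷ y →
                           Within (barrier L r′) j x ×
                           (∀ {m} → InRange (node (just L) R , suc r′) m → r′ < m → m ∈ x)
occurrence-in-left-child {L} {nothing} {r′} _ _ j∉root eq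
  with _ , refl , eq₁ ← occurrence-++ʳ [ suc r′ ] j∉root eq
  with occurrence-++ (barrier L r′) eq₁
... | inj₁ (_ , occ)     = Within-++ [ suc r′ ] (Within-here occ) , λ m∈ → above-root (proj₂ m∈)
... | inj₂ (_ , _ , occ) = contradiction (occurrence⇒∈ occ) j∉root
occurrence-in-left-child {L} {just R} {r′} v j∈L j∉root eq
  with _ , refl , eq₁ ← occurrence-++ʳ [ suc r′ ] j∉root eq
  with occurrence-++ (barrier L r′) eq₁
... | inj₁ (_ , occ) = Within-++ [ suc r′ ] (Within-here occ) , λ m∈ → above-root (proj₂ m∈)
... | inj₂ (_ , refl , eq₂)
  with _ , refl , eq₃ ← occurrence-++ʳ (suc r′ ∷ barrier R (r′ ∸ size L))
                          (∉-++ [ suc r′ ] j∉root (left-label∉right v j∈L)) eq₂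
  with _ , refl , eq₄ ← occurrence-++ʳ [ suc r′ ] j∉root eq₃
  with occurrence-++ (barrier L r′) eq₄
...   | inj₁ (_ , occ) =
          Within-++ [ suc r′ ] (Within-++ (barrier L r′) (Within-++ (suc r′ ∷ barrier R (r′ ∸ size L))
            (Within-++ [ suc r′ ] (Within-here occ))))
        , λ m∈ → above-root (proj₂ m∈)
...   | inj₂ (_ , _ , occ) = contradiction (occurrence⇒∈ occ) j∉root

occurrence-in-right-child : ∀ {l R r′ x j y} → Valid (node l (just R) , suc r′) →
                            InRange (R , r′ ∸ sizeM l) j → j ∉ [ suc r′ ] →
                            barrier (node l (just R)) (suc r′) ≡ x ++ j ∷ y →
                            Within (barrier R (r′ ∸ sizeM l)) j x ×
                            (∀ {m} → InRange (node l (just R) , suc r′) m → r′ ∸ sizeM l < m → m ∈ x)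
occurrence-in-right-child {nothing} {R} {r′} _ _ j∉root eq
  with _ , refl , eq₁ ← occurrence-++ʳ [ suc r′ ] j∉root eq
  with occurrence-++ (barrier R r′) eq₁
... | inj₁ (_ , occ)     = Within-++ [ suc r′ ] (Within-here occ) , λ m∈ → above-root (proj₂ m∈)
... | inj₂ (_ , _ , occ) = contradiction (occurrence⇒∈ occ) j∉root
occurrence-in-right-child {just L} {R} {r′} v j∈R j∉root eq
  with _ , refl , eq₁ ← occurrence-++ʳ (suc r′ ∷ barrier L r′)
                          (∉-++ [ suc r′ ] j∉root (right-label∉left v j∈R)) eq
  with _ , refl , eq₂ ← occurrence-++ʳ [ suc r′ ] j∉root eq₁
  with occurrence-++ (barrier R (r′ ∸ size L)) eq₂
... | inj₁ (_ , occ) =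
  Within-++ (suc r′ ∷ barrier L r′) (Within-++ [ suc r′ ] (Within-here occ)) , above
  where
  above : ∀ {m} → InRange (node (just L) (just R) , suc r′) m → r′ ∸ size L < m →
          m ∈ suc r′ ∷ barrier L r′ ++ _
  above m∈ mid<m with InRange-node {just L} {just R} m∈
  ... | inj₁ refl               = here refl
  ... | inj₂ (inj₁ m∈L)         =
    there (∈-++⁺ˡ (InRange⇒∈barrier (Child-valid (left {L} {just R}) v) m∈L))
  ... | inj₂ (inj₂ (_ , m≤mid)) = contradiction m≤mid (<⇒≱ mid<m)
... | inj₂ (_ , _ , occ)
  with _ , _ , occ′ ← occurrence-++ʳ (suc r′ ∷ barrier L r′)
                        (∉-++ [ suc r′ ] j∉root (right-label∉left v j∈R)) occ
  = contradiction (occurrence⇒∈ occ′) j∉root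

occurrence-in-child : ∀ {t r c rc x j y} → Child (t , r) (c , rc) → Valid (t , r) →
                      InRange (c , rc) j → barrier t r ≡ x ++ j ∷ y →
                      Within (barrier c rc) j x × (∀ {m} → InRange (t , r) m → rc < m → m ∈ x)
occurrence-in-child c@left  v@(s≤s _) j∈ = occurrence-in-left-child v j∈ (child-label∉root c v j∈)
occurrence-in-child c@right v@(s≤s _) j∈ = occurrence-in-right-child v j∈ (child-label∉root c v j∈)

occurrence-within-subtree : ∀ {t r ti i j x y} → Valid (t , r) → Star Child (t , r) (ti , i) →
                            InRange (ti , i) j → barrier t r ≡ x ++ j ∷ y →
                            Within (barrier ti i) j x
occurrence-within-subtree _ ε          _  eq = Within-here eq
occurrence-within-subtree v (c ◅ path) j∈ eq =
  Within-trans (proj₁ (occurrence-in-child c v (Star-InRange path (Child-valid c v) j∈) eq))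
               (occurrence-within-subtree (Child-valid c v) path j∈)

labels-above-precede-occurrence : ∀ {t r tj j x y m} → Valid (t , r) → Star Child (t , r) (tj , j) →
                                  barrier t r ≡ x ++ j ∷ y → j ≤ m → m ≤ r → m ∈ x ⊎ m ≡ j
labels-above-precede-occurrence _ ε _ j≤m m≤r = inj₂ (≤-antisym m≤r j≤m)
labels-above-precede-occurrence {m = m} v (_◅_ {j = _ , rc} c path) eq j≤m m≤r
  with (x₁ , _ , refl , _ , occ) , above ←
         occurrence-in-child c v (path⇒InRange (Child-valid c v) path) eq
  with m ≤? rc
... | yes m≤rc =
  Sum.map₁ (∈-++⁺ʳ x₁) (labels-above-precede-occurrence (Child-valid c v) path occ j≤m m≤rc)
... | no  m≰rc =
  inj₁ (above (<-≤-trans (proj₁ (path⇒InRange v (c ◅ path))) j≤m , m≤r) (≰⇒> m≰rc))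

factor-contains-interval : ∀ {t r ti i tj j k mid m} → Valid (t , r) →
                           Star Child (t , r) (ti , i) → Star Child (ti , i) (tj , j) →
                           k ∉ barrier ti i → IsFactor (k ∷ mid ++ [ j ]) (barrier t r) →
                           j ≤ m → m ≤ i → m ∈ k ∷ mid ++ [ j ]
factor-contains-interval {mid = mid} v root→i i→j k∉ factor j≤m m≤i
  with _ , _ , B≡ ← bracketed-factor⇒occurrence factor
  with x₁ , x₂ , x≡ , _ , occ ←
         occurrence-within-subtree v root→i (path⇒InRange (Star-valid root→i v) i→j) B≡
  with labels-above-precede-occurrence (Star-valid root→i v) i→j occ j≤m m≤i
... | inj₂ refl = there (∈-++⁺ʳ mid (here refl))
... | inj₁ m∈x₂
  with q , refl ← suffix-after-∉ x₁ (sym x≡) (λ k∈x₂ → k∉ (subst (_ ∈_) (sym occ) (∈-++⁺ˡ k∈x₂)))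
  = there (∈-++⁺ˡ (∈-++⁺ʳ q m∈x₂))

module _ {ℓ} (T : IndexTree ℓ) where

  node-valid : ∀ {s} → Star Child (tree T , ℓ) s → Valid s
  node-valid root→s = Star-valid root→s (≤-reflexive (size≡ℓ T))

  InSubtree⇒path : ∀ {ti i j} → Star Child (tree T , ℓ) (ti , i) → InSubtree T i j →
                   ∃ λ tj → Star Child (ti , i) (tj , j)
  InSubtree⇒path _      ε        = _ , ε
  InSubtree⇒path root→i (e ◅ es)
    with _ , root→p , _ , step ← edge⇒path (tree T) ℓ e
    with refl ← subtree-unique (node-valid ε) root→p root→i
    = map₂ (step ◅_) (InSubtree⇒path (root→i ◅◅ step ◅ ε) es)

proposition3p8 : (ℓ : ℕ) → 1 ≤ ℓ → (T : IndexTree ℓ) → (i j i′ : ℕ)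
    → 1 ≤ i → i ≤ ℓ → 1 ≤ j → j ≤ ℓ
    → InSubtree T i j → IsParent T i′ i
    → (f : List ℕ) → IsFactor f (B T)
    → (∃ λ g → f ≡ i′ ∷ g) → (∃ λ h → f ≡ h ++ [ j ])
    → (m : ℕ) → j ≤ m → m ≤ i → m ∈ f
proposition3p8 ℓ _ T i j i′ _ _ _ _ j∈𝒯i parent f factor (_ , f≡i′∷g) (_ , f≡h++j) m j≤m m≤i
  with _ , root→i′ , _ , i′→i ← edge⇒path (tree T) ℓ parent
  with _ , i→j ← InSubtree⇒path T (root→i′ ◅◅ i′→i ◅ ε) j∈𝒯i
  with _ , refl ← split-ends f≡i′∷g f≡h++j
                    (>⇒≢ (descendant-label<parent (node-valid T root→i′) i′→i i→j))
  = factor-contains-interval (node-valid T ε) (root→i′ ◅◅ i′→i ◅ ε) i→j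
      (parent∉barrier (node-valid T root→i′) i′→i) factor j≤m m≤i
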